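{- Let $\mathbf{u}$ be an infinite word over a finite alphabet $\mathcal{A}$ whose language is closed under $\Theta$. If $\mathcal{P}_\Theta(1)+\mathcal{P}_\Theta(2)=\mathcal{C}(2)-\mathcal{C}(1)+2$, then for every letter $a$ with $a\neq\Theta(a)$, the occurrences of $a$ and $\Theta(a)$ in $\mathbf{u}$ alternate.
   Context: $\Theta$ is an involutory antimorphism of $\mathcal{A}^*$ ($\Theta^2=\mathrm{id}$, $\Theta(vw)=\Theta(w)\Theta(v)$); a word $v$ is a $\Theta$-palindrome if $\Theta(v)=v$. The language of $\mathbf{u}$ (set of finite factors) is closed under $\Theta$ if it contains $\Theta(w)$ for each of its elements $w$. $\mathcal{C}(n)$ is the number of factors of length $n$ and $\mathcal{P}_\Theta(n)$ the number of $\Theta$-palindromic factors of length $n$. Occurrences of $a$ and $\Theta(a)$ alternate if there is no factor of length at least $2$ beginning and ending with $a$ and not containing $\Theta(a)$, and likewise with $a,\Theta(a)$ exchanged. -}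

module Defs where

open import Data.Nat using (ℕ; _+_; _≤_)
open import Data.Fin using (Fin)
open import Data.List using (List; []; _∷_; _++_; map; reverse; length; upTo)
open import Data.List.Membership.Propositional using (_∈_)
open import Data.List.Relation.Unary.Unique.Propositional using (Unique)
open import Data.Product using (Σ; ∃-syntax; _×_)
open import Function.Bundles using (_⇔_)
open import Relation.Binary.PropositionalEquality using (_≡_)
open import Relation.Nullary using (¬_)

Word : ℕ → Set
Word k = List (Fin k)

InfWord : ℕ → Set
InfWord k = ℕ → Fin k

-- An involutory antimorphism Θ of A* is determined by an involution θ on
-- letters:  Θ(w) = reverse (map θ w).
IsInvolution : {k : ℕ} → (Fin k → Fin k) → Set
IsInvolution θ = ∀ a → θ (θ a) ≡ a

Θ : {k : ℕ} → (Fin k → Fin k) → Word k → Word k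
Θ θ w = reverse (map θ w)

factorAt : {k : ℕ} → InfWord k → ℕ → ℕ → Word k
factorAt u i n = map (λ j → u (i + j)) (upTo n)

Factor : {k : ℕ} → InfWord k → Word k → Set
Factor u w = ∃[ i ] (factorAt u i (length w) ≡ w)

ClosedUnder : {k : ℕ} → InfWord k → (Fin k → Fin k) → Set
ClosedUnder u θ = ∀ w → Factor u w → Factor u (Θ θ w)

HasCount : {k : ℕ} → (Word k → Set) → ℕ → Set
HasCount {k} P m =
  Σ (List (Word k)) λ L → Unique L × length L ≡ m × (∀ w → (w ∈ L) ⇔ P w)

Complexity : {k : ℕ} → InfWord k → ℕ → ℕ → Set
Complexity u n m = HasCount (λ w → Factor u w × length w ≡ n) m

PalComplexity : {k : ℕ} → InfWord k → (Fin k → Fin k) → ℕ → ℕ → Set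
PalComplexity u θ n m =
  HasCount (λ w → Factor u w × length w ≡ n × Θ θ w ≡ w) m

NoGap : {k : ℕ} → InfWord k → Fin k → Fin k → Set
NoGap u a b = ¬ (∃[ m ] (Factor u (a ∷ m ++ a ∷ []) × ¬ (b ∈ (a ∷ m ++ a ∷ []))))

Alternate : {k : ℕ} → InfWord k → Fin k → Fin k → Set
Alternate u a b = NoGap u a b × NoGap u b a

module Submission where

-- Suppose a gap a m a avoiding θ a occurs. Traverse u from the gap outwards (rightwards, then
-- leftwards), so that each newly met class {x, θ x} of letters is reached through a factor of length 2
-- joining it to a class met earlier. Such a discovery edge is never a Θ-palindrome and determines the
-- later class, so the letters outside {a, θ a}, together with the Θ-palindromic letters, inject into the
-- discovery edges and their Θ-images. The letters a and θ a go to the factor closing the gap and its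
-- Θ-image, which are not discovery edges because the gap avoids θ a, and the Θ-palindromic factors of
-- length 2 go to themselves. Hence C(1) + P(1) + P(2) ≤ C(2), contradicting the hypothesis.

open import Defs
open import Data.Nat using (ℕ; zero; suc; _+_; _∸_; _≤_; _≰_; _<_; z≤n; s≤s; s≤s⁻¹)
open import Data.Nat.Properties hiding (_≟_)
open import Data.Fin using (Fin; _≟_)
open import Data.List using (List; []; _∷_; _++_; length; map; reverse; applyUpTo)
open import Data.List.Properties
  using (∷-injective; ∷-injectiveˡ; ∷-injectiveʳ; length-map; length-++; length-removeAt′; map-upTo;
         reverse-map; reverse-involutive; map-∘; map-cong; map-id)
open import Data.List.Membership.Propositional using (_∈_; _─_)
open import Data.List.Membership.Propositional.Properties using (∈-map⁻)
open import Data.List.Relation.Unary.Any using (here; there; index)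
open import Data.List.Relation.Unary.All as All using (All)
import Data.List.Relation.Unary.All.Properties as All
open import Data.List.Relation.Unary.AllPairs using (_∷_)
open import Data.List.Relation.Unary.Unique.Propositional using (Unique)
import Data.List.Relation.Unary.Unique.Propositional.Properties as Unique
open import Data.Product using (∃-syntax; ∃₂; _×_; _,_; proj₁; proj₂)
open import Data.Sum using (_⊎_; inj₁; inj₂; swap; [_,_])
open import Data.Sum.Properties using (inj₁-injective; inj₂-injective)
open import Function using (_∘_; id)
open import Function.Bundles using (Equivalence)
open import Relation.Binary.PropositionalEquality hiding ([_])
open import Relation.Nullary using (¬_; Dec; yes; no; contradiction)
open import Relation.Nullary.Decidable using (_⊎-dec_)
open import Relation.Unary using (Decidable)

module _ {A B : Set} where

  ∈-─ : ∀ {x y : B} {ys} (x∈ys : x ∈ ys) → y ∈ ys → y ≢ x → y ∈ ys ─ x∈ys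
  ∈-─ (here refl) (here refl) y≢x = contradiction refl y≢x
  ∈-─ (here _)    (there y∈ys) _  = y∈ys
  ∈-─ (there _)   (here refl)  _  = here refl
  ∈-─ (there x∈ys) (there y∈ys) y≢x = there (∈-─ x∈ys y∈ys y≢x)

  length-≤-injection : (f : A → B) {xs : List A} {ys : List B} → Unique xs →
    (∀ {x} → x ∈ xs → f x ∈ ys) →
    (∀ {x x'} → x ∈ xs → x' ∈ xs → f x ≡ f x' → x ≡ x') →
    length xs ≤ length ys
  length-≤-injection f {[]} _ _ _ = z≤n
  length-≤-injection f {x ∷ xs} {ys} (x∉xs ∷ xs!) into inj =
    subst (suc (length xs) ≤_) (sym (length-removeAt′ ys (index fx∈ys)))
      (s≤s (length-≤-injection f xs! into′ (λ p p' → inj (there p) (there p'))))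
    where
    fx∈ys = into (here refl)
    into′ : ∀ {x'} → x' ∈ xs → f x' ∈ ys ─ fx∈ys
    into′ p = ∈-─ fx∈ys (into (there p))
      (λ fx'≡fx → All.lookup x∉xs p (inj (here refl) (there p) (sym fx'≡fx)))

  tagged : List A → List B → List (A ⊎ B)
  tagged xs ys = map inj₁ xs ++ map inj₂ ys

  length-tagged : ∀ xs ys → length (tagged xs ys) ≡ length xs + length ys
  length-tagged xs ys = begin
    length (tagged xs ys)                      ≡⟨ length-++ (map inj₁ xs) ⟩
    length (map inj₁ xs) + length (map inj₂ ys) ≡⟨ cong₂ _+_ (length-map inj₁ xs) (length-map inj₂ ys) ⟩
    length xs + length ys                      ∎
    where open ≡-Reasoning

  Unique-tagged : ∀ {xs ys} → Unique xs → Unique ys → Unique (tagged xs ys)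
  Unique-tagged xs! ys! = Unique.++⁺ (Unique.map⁺ inj₁-injective xs!) (Unique.map⁺ inj₂-injective ys!) disjoint
    where
    disjoint : ∀ {xs ys} {d : A ⊎ B} → ¬ (d ∈ map inj₁ xs × d ∈ map inj₂ ys)
    disjoint (d∈xs , d∈ys) with ∈-map⁻ inj₁ d∈xs | ∈-map⁻ inj₂ d∈ys
    ... | _ , _ , refl | _ , _ , ()

  All-tagged : ∀ {P : A ⊎ B → Set} {xs ys} → All (P ∘ inj₁) xs → All (P ∘ inj₂) ys → All P (tagged xs ys)
  All-tagged pxs pys = All.++⁺ (All.map⁺ pxs) (All.map⁺ pys)

-- the least i < n with P i, or n if there is none
least : {P : ℕ → Set} → Decidable P → ℕ → ℕ
least P? zero = zero
least P? (suc n) with P? 0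
... | yes _ = zero
... | no  _ = suc (least (P? ∘ suc) n)

least-≤ : ∀ {P : ℕ → Set} (P? : Decidable P) n → least P? n ≤ n
least-≤ P? zero = z≤n
least-≤ P? (suc n) with P? 0
... | yes _ = z≤n
... | no  _ = s≤s (least-≤ (P? ∘ suc) n)

least-minimal : ∀ {P : ℕ → Set} (P? : Decidable P) {n i} → i < n → P i → least P? n ≤ i
least-minimal P? {suc n} i<n Pi with P? 0
least-minimal P? {suc n} {i}     _          Pi | yes _   = z≤n
least-minimal P? {suc n} {zero}  _          P0 | no ¬P0 = contradiction P0 ¬P0
least-minimal P? {suc n} {suc i} (s≤s i<n) Pi | no _    = s≤s (least-minimal (P? ∘ suc) i<n Pi)

least-satisfies : ∀ {P : ℕ → Set} (P? : Decidable P) n → least P? n < n → P (least P? n)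
least-satisfies P? (suc n) lt with P? 0
... | yes P0 = P0
... | no  _  = least-satisfies (P? ∘ suc) n (s≤s⁻¹ lt)

least-mono : ∀ {P Q : ℕ → Set} (P? : Decidable P) (Q? : Decidable Q) →
  (∀ {i} → P i → Q i) → ∀ n → least Q? n ≤ least P? n
least-mono P? Q? P⇒Q n with m≤n⇒m<n∨m≡n (least-≤ P? n)
... | inj₁ lt  = least-minimal Q? lt (P⇒Q (least-satisfies P? n lt))
... | inj₂ eq = subst (least Q? n ≤_) (sym eq) (least-≤ Q? n)

least-cong : ∀ {P Q : ℕ → Set} (P? : Decidable P) (Q? : Decidable Q) →
  (∀ {i} → P i → Q i) → (∀ {i} → Q i → P i) → ∀ n → least P? n ≡ least Q? n
least-cong P? Q? P⇒Q Q⇒P n = ≤-antisym (least-mono Q? P? Q⇒P n) (least-mono P? Q? P⇒Q n)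

Θ-involutive : ∀ {k} {θ : Fin k → Fin k} → IsInvolution θ → ∀ w → Θ θ (Θ θ w) ≡ w
Θ-involutive {θ = θ} θ-inv w = begin
  reverse (map θ (reverse (map θ w))) ≡⟨ cong reverse (reverse-map θ (map θ w)) ⟩
  reverse (reverse (map θ (map θ w))) ≡⟨ reverse-involutive (map θ (map θ w)) ⟩
  map θ (map θ w)                     ≡⟨ map-∘ w ⟨
  map (θ ∘ θ) w                       ≡⟨ map-cong θ-inv w ⟩
  map id w                            ≡⟨ map-id w ⟩
  w                                   ∎
  where open ≡-Reasoning

factorAt-2 : ∀ {k} (u : InfWord k) p → factorAt u p 2 ≡ u p ∷ u (suc p) ∷ []
factorAt-2 u p = cong₂ (λ x y → x ∷ y ∷ []) (cong u (+-identityʳ p)) (cong u (+-comm p 1))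

module _ {A : Set} where

  applyUpTo-∈ : ∀ (f : ℕ → A) xs y → applyUpTo f (length (xs ++ y ∷ [])) ≡ xs ++ y ∷ [] →
    ∀ {t} → t ≤ length xs → f t ∈ xs ++ y ∷ []
  applyUpTo-∈ f []       y eq z≤n     = here (∷-injectiveˡ eq)
  applyUpTo-∈ f (x ∷ xs) y eq {zero}  _ = here (∷-injectiveˡ eq)
  applyUpTo-∈ f (x ∷ xs) y eq {suc t} (s≤s t≤) = there (applyUpTo-∈ (f ∘ suc) xs y (∷-injectiveʳ eq) t≤)

  applyUpTo-last : ∀ (f : ℕ → A) xs y → applyUpTo f (length (xs ++ y ∷ [])) ≡ xs ++ y ∷ [] →
    f (length xs) ≡ y
  applyUpTo-last f []       y eq = ∷-injectiveˡ eq
  applyUpTo-last f (x ∷ xs) y eq = applyUpTo-last (f ∘ suc) xs y (∷-injectiveʳ eq)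

occurrence-bound : ∀ {k} (u : InfWord k) (L : List (Word k)) → (∀ {w} → w ∈ L → Factor u w) →
  ∃[ B ] ∀ {w} → w ∈ L → ∃[ j ] j ≤ B × factorAt u j (length w) ≡ w
occurrence-bound u []      _      = 0 , λ ()
occurrence-bound u (w ∷ L) factor with factor (here refl) | occurrence-bound u L (factor ∘ there)
... | j , occ | B , bounded = j + B , λ where
  (here refl)  → j , m≤m+n j B , occ
  (there w∈L) → let j' , j'≤B , occ' = bounded w∈L in j' , ≤-trans j'≤B (m≤n+m B j) , occ'

m+[n∸m+2]≰n : ∀ m n → ¬ m + ((n ∸ m) + 2) ≤ n
m+[n∸m+2]≰n m n le = m+1+n≰m n (begin
  n + 2           ≤⟨ +-monoˡ-≤ 2 (m≤n+m∸n n m) ⟩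
  m + (n ∸ m) + 2 ≡⟨ +-assoc m (n ∸ m) 2 ⟩
  m + (n ∸ m + 2) ≤⟨ le ⟩
  n               ∎)
  where open ≤-Reasoning

-- visit 0, …, visit R lists letters of u, each visit ρ with ρ ≥ 1 joined by the factor at position
-- start ρ to an earlier one; the indices 0, …, r walk along a gap from a to a that avoids θ a.
module Spanning
  {k : ℕ} (u : InfWord k) (θ : Fin k → Fin k) (θ-inv : IsInvolution θ) (closed : ClosedUnder u θ)
  (visit : ℕ → Fin k) (start : ℕ → ℕ) (R : ℕ)
  (links-back : ∀ ρ → 1 ≤ ρ → ρ ≤ R → ∃[ ρ' ] ρ' < ρ ×
    (factorAt u (start ρ) 2 ≡ visit ρ' ∷ visit ρ ∷ [] ⊎ factorAt u (start ρ) 2 ≡ visit ρ ∷ visit ρ' ∷ []))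
  (a : Fin k) (a≢θa : a ≢ θ a) (r : ℕ) (1≤r : 1 ≤ r) (r≤R : r ≤ R)
  (visit-0 : visit 0 ≡ a) (visit-r : visit r ≡ a)
  (walk : ∀ t → 1 ≤ t → t ≤ r → factorAt u (start t) 2 ≡ visit (t ∸ 1) ∷ visit t ∷ [])
  (avoid : ∀ t → t ≤ r → visit t ≢ θ a)
  where

  edge : ℕ → Word k
  edge ρ = factorAt u (start ρ) 2

  Visited : Fin k → Set
  Visited x = ∃[ ρ ] ρ ≤ R × visit ρ ≡ x

  infix 4 _∼_ _≃_

  _∼_ : Fin k → Fin k → Set
  x ∼ y = x ≡ y ⊎ x ≡ θ y

  _∼?_ : ∀ x y → Dec (x ∼ y)
  x ∼? y = (x ≟ y) ⊎-dec (x ≟ θ y)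

  ∼-sym : ∀ {x y} → x ∼ y → y ∼ x
  ∼-sym (inj₁ refl) = inj₁ refl
  ∼-sym (inj₂ refl) = inj₂ (sym (θ-inv _))

  ∼-trans : ∀ {x y z} → x ∼ y → y ∼ z → x ∼ z
  ∼-trans (inj₁ refl) y∼z         = y∼z
  ∼-trans (inj₂ refl) (inj₁ refl) = inj₂ refl
  ∼-trans (inj₂ refl) (inj₂ refl) = inj₁ (θ-inv _)

  θ∼ : ∀ x → θ x ∼ x
  θ∼ x = inj₂ refl

  -- the index at which the class {y, θ y} is first visited (R + 1 if it is not visited)
  first : Fin k → ℕ
  first y = least (λ ρ → visit ρ ∼? y) (suc R)

  first-≤ : ∀ {ρ y} → ρ ≤ R → visit ρ ∼ y → first y ≤ ρ
  first-≤ ρ≤R = least-minimal (λ ρ → visit ρ ∼? _) (s≤s ρ≤R)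

  first-visited : ∀ {y} → Visited y → first y ≤ R × visit (first y) ∼ y
  first-visited (ρ , ρ≤R , refl) =
    first≤R , least-satisfies (λ ρ → visit ρ ∼? _) (suc R) (s≤s first≤R)
    where first≤R = ≤-trans (first-≤ ρ≤R (inj₁ refl)) ρ≤R

  first-∼ : ∀ {y y'} → y ∼ y' → first y ≡ first y'
  first-∼ y∼y' = least-cong (λ ρ → visit ρ ∼? _) (λ ρ → visit ρ ∼? _)
    (λ v∼y → ∼-trans v∼y y∼y') (λ v∼y' → ∼-trans v∼y' (∼-sym y∼y')) (suc R)

  first-a : first a ≡ 0
  first-a = n≤0⇒n≡0 (first-≤ z≤n (inj₁ visit-0))

  nonroot⇒first>0 : ∀ {x} → Visited x → ¬ x ∼ a → 0 < first x
  nonroot⇒first>0 {x} vx x≁a with first x in eq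
  ... | suc _ = s≤s z≤n
  ... | zero  = contradiction (∼-trans (∼-sym visit-0∼x) (inj₁ visit-0)) x≁a
    where
    visit-0∼x : visit 0 ∼ x
    visit-0∼x = subst (λ ρ → visit ρ ∼ x) eq (proj₂ (first-visited vx))

  ∼-≢⇒≡θ : ∀ {p x} → p ∼ x → p ≢ x → p ≡ θ x
  ∼-≢⇒≡θ (inj₁ p≡x) p≢x = contradiction p≡x p≢x
  ∼-≢⇒≡θ (inj₂ p≡θx) _ = p≡θx

  θ-injective : ∀ {x y} → θ x ≡ θ y → x ≡ y
  θ-injective {x} {y} eq = trans (sym (θ-inv x)) (trans (cong θ eq) (θ-inv y))

  pal⇒nonroot : ∀ {x} → θ x ≡ x → ¬ x ∼ a
  pal⇒nonroot θa≡a (inj₁ refl) = a≢θa (sym θa≡a)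
  pal⇒nonroot θθa≡θa (inj₂ refl) = a≢θa (trans (sym (θ-inv a)) θθa≡θa)

  visit-first-pal : ∀ {x} → θ x ≡ x → Visited x → visit (first x) ≡ x
  visit-first-pal θx≡x vx with proj₂ (first-visited vx)
  ... | inj₁ v≡x  = v≡x
  ... | inj₂ v≡θx = trans v≡θx θx≡x

  Splits : ℕ → Word k → Set
  Splits ρ g = ∃₂ λ y y' → (g ≡ y ∷ y' ∷ [] ⊎ g ≡ y' ∷ y ∷ []) × first y ≡ ρ × first y' < ρ

  splits-unique : ∀ {ρ ρ' g} → Splits ρ g → Splits ρ' g → ρ ≡ ρ'
  splits-unique (y , y' , inj₁ refl , refl , _) (z , z' , inj₁ e , refl , _) =
    cong first (∷-injectiveˡ e)
  splits-unique (y , y' , inj₂ refl , refl , _) (z , z' , inj₂ e , refl , _) =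
    cong first (∷-injectiveˡ (∷-injectiveʳ e))
  splits-unique (y , y' , inj₁ refl , refl , y'<y) (z , z' , inj₂ e , refl , z'<z) with ∷-injective e
  ... | refl , refl = contradiction y'<y (<-asym z'<z)
  splits-unique (y , y' , inj₂ refl , refl , y'<y) (z , z' , inj₁ e , refl , z'<z) with ∷-injective e
  ... | refl , refl = contradiction y'<y (<-asym z'<z)

  splits-Θ : ∀ {ρ g} → Splits ρ g → Splits ρ (Θ θ g)
  splits-Θ (y , y' , inj₁ refl , first-y , y'<) =
    θ y , θ y' , inj₂ refl , trans (first-∼ (θ∼ y)) first-y , subst (_< _) (sym (first-∼ (θ∼ y'))) y'<
  splits-Θ (y , y' , inj₂ refl , first-y , y'<) =
    θ y , θ y' , inj₁ refl , trans (first-∼ (θ∼ y)) first-y , subst (_< _) (sym (first-∼ (θ∼ y'))) y'<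

  splits-nonpal : ∀ {ρ g} → Splits ρ g → Θ θ g ≢ g
  splits-nonpal (y , y' , inj₁ refl , refl , y'<y) pal =
    <-irrefl (sym (first-∼ (inj₂ (sym (∷-injectiveˡ pal))))) y'<y
  splits-nonpal (y , y' , inj₂ refl , refl , y'<y) pal =
    <-irrefl (first-∼ (inj₂ (sym (∷-injectiveˡ pal)))) y'<y

  ¬splits-square : ∀ {ρ x} → ¬ Splits ρ (x ∷ x ∷ [])
  ¬splits-square (y , y' , inj₁ e , refl , y'<y) =
    <-irrefl (cong first (trans (sym (∷-injectiveˡ (∷-injectiveʳ e))) (∷-injectiveˡ e))) y'<y
  ¬splits-square (y , y' , inj₂ e , refl , y'<y) =
    <-irrefl (cong first (trans (sym (∷-injectiveˡ e)) (∷-injectiveˡ (∷-injectiveʳ e)))) y'<y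

  _≃_ : Word k → Word k → Set
  g ≃ h = g ≡ h ⊎ g ≡ Θ θ h

  ≃-splits : ∀ {ρ g h} → g ≃ h → Splits ρ h → Splits ρ g
  ≃-splits (inj₁ refl) s = s
  ≃-splits (inj₂ refl) s = splits-Θ s

  ≃-euclidean : ∀ {g h h'} → g ≃ h → g ≃ h' → h ≃ h'
  ≃-euclidean (inj₁ refl) g≃h' = g≃h'
  ≃-euclidean {h = h} (inj₂ refl) (inj₁ Θh≡h') = inj₂ (trans (sym (Θ-involutive θ-inv h)) (cong (Θ θ) Θh≡h'))
  ≃-euclidean {h = h} {h'} (inj₂ refl) (inj₂ Θh≡Θh') =
    inj₁ (trans (sym (Θ-involutive θ-inv h)) (trans (cong (Θ θ) Θh≡Θh') (Θ-involutive θ-inv h')))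

  ≃-nonpal : ∀ {g h} → g ≃ h → Θ θ h ≢ h → Θ θ g ≢ g
  ≃-nonpal (inj₁ refl) h-nonpal = h-nonpal
  ≃-nonpal {h = h} (inj₂ refl) h-nonpal pal = h-nonpal (sym (trans (sym (Θ-involutive θ-inv h)) pal))

  ≃-edge-factor : ∀ {g ρ} → g ≃ edge ρ → Factor u g × length g ≡ 2
  ≃-edge-factor {ρ = ρ} (inj₁ refl) = (start ρ , refl) , refl
  ≃-edge-factor {ρ = ρ} (inj₂ refl) = closed (edge ρ) (start ρ , refl) , refl

  tree : Fin k → Word k
  tree x = edge (first x)

  tree-splits : ∀ {x} → Visited x → ¬ x ∼ a → Splits (first x) (tree x)
  tree-splits {x} vx x≁a with first-visited vx
  ... | first≤R , v∼x with links-back (first x) (nonroot⇒first>0 vx x≁a) first≤R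
  ... | ρ' , ρ'<first , joins =
    visit (first x) , visit ρ' , swap joins , first-∼ v∼x ,
    ≤-<-trans (first-≤ (≤-trans (<⇒≤ ρ'<first) first≤R) (inj₁ refl)) ρ'<first

  ≃-tree-first : ∀ {g x x'} → Visited x → ¬ x ∼ a → Visited x' → ¬ x' ∼ a →
    g ≃ tree x → g ≃ tree x' → first x ≡ first x'
  ≃-tree-first vx x≁a vx' x'≁a g≃t g≃t' =
    splits-unique (≃-splits g≃t (tree-splits vx x≁a)) (≃-splits g≃t' (tree-splits vx' x'≁a))

  closing : Word k
  closing = edge r

  z : Fin k
  z = visit (r ∸ 1)

  z-visited : Visited z
  z-visited = r ∸ 1 , ≤-trans (m∸n≤m r 1) r≤R , refl

  z≢θa : z ≢ θ a
  z≢θa = avoid (r ∸ 1) (m∸n≤m r 1)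

  closing≡za : closing ≡ z ∷ a ∷ []
  closing≡za = trans (walk r 1≤r ≤-refl) (cong (λ y → z ∷ y ∷ []) visit-r)

  closing-nonpal : Θ θ closing ≢ closing
  closing-nonpal pal =
    z≢θa (sym (∷-injectiveˡ (trans (cong (Θ θ) (sym closing≡za)) (trans pal closing≡za))))

  closing-splits : ¬ z ∼ a → Splits (first z) closing
  closing-splits z≁a =
    z , a , inj₁ closing≡za , refl , subst (_< first z) (sym first-a) (nonroot⇒first>0 z-visited z≁a)

  first-z≤r : first z ≤ r
  first-z≤r = ≤-trans (first-≤ (proj₁ (proj₂ z-visited)) (inj₁ refl)) (m∸n≤m r 1)

  -- The class of z is reached while walking the gap, which avoids θ a and meets a only at its ends.
  tree-z≄closing : ¬ z ∼ a → ¬ tree z ≃ closing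
  tree-z≄closing z≁a t≃c
    with tree≡ ← walk (first z) (nonroot⇒first>0 z-visited z≁a) first-z≤r | t≃c
  ... | inj₁ t≡c = z≁a (∼-trans (∼-sym (proj₂ (first-visited z-visited)))
                                (inj₁ (∷-injectiveˡ (∷-injectiveʳ (trans (sym tree≡) (trans t≡c closing≡za))))))
  ... | inj₂ t≡Θc = avoid (first z ∸ 1) (≤-trans (m∸n≤m (first z) 1) first-z≤r)
                      (∷-injectiveˡ (trans (sym tree≡) (trans t≡Θc (cong (Θ θ) closing≡za))))

  -- The closing edge is the one edge not on the spanning tree that the gap provides.
  tree≄closing : ∀ {g y} → Visited y → ¬ y ∼ a → g ≃ tree y → ¬ g ≃ closing
  tree≄closing {g} {y} vy y≁a g≃t g≃c with z ≟ a
  ... | yes z≡a = ¬splits-square (subst (Splits (first y)) (trans closing≡za (cong (_∷ a ∷ []) z≡a)) splits-closing)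
    where splits-closing = ≃-splits (≃-euclidean g≃c g≃t) (tree-splits vy y≁a)
  ... | no z≢a = tree-z≄closing z≁a (subst (_≃ closing) (cong edge first-y≡first-z) (≃-euclidean g≃t g≃c))
    where
    z≁a : ¬ z ∼ a
    z≁a = [ z≢a , z≢θa ]
    first-y≡first-z : first y ≡ first z
    first-y≡first-z = splits-unique (≃-splits (≃-euclidean g≃c g≃t) (tree-splits vy y≁a)) (closing-splits z≁a)

  rootImage : Fin k → Word k
  rootImage x with x ≟ a
  ... | yes _ = closing
  ... | no  _ = Θ θ closing

  rootImage-≃ : ∀ {x} → x ∼ a → rootImage x ≃ closing
  rootImage-≃ {x} x∼a with x ≟ a
  ... | yes _ = inj₁ refl
  ... | no  _ = inj₂ refl

  rootImage-injective : ∀ {x x'} → x ∼ a → x' ∼ a → rootImage x ≡ rootImage x' → x ≡ x'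
  rootImage-injective {x} {x'} x∼a x'∼a eq with x ≟ a | x' ≟ a
  ... | yes refl | yes refl = refl
  ... | yes refl | no x'≢a  = contradiction (sym eq) closing-nonpal
  ... | no x≢a   | yes refl = contradiction eq closing-nonpal
  ... | no x≢a   | no x'≢a  = trans (∼-≢⇒≡θ x∼a x≢a) (sym (∼-≢⇒≡θ x'∼a x'≢a))

  treeImage : Fin k → Word k
  treeImage x with visit (first x) ≟ x
  ... | yes _ = tree x
  ... | no  _ = Θ θ (tree x)

  treeImage-cases : ∀ x → (visit (first x) ≡ x × treeImage x ≡ tree x)
                        ⊎ (visit (first x) ≢ x × treeImage x ≡ Θ θ (tree x))
  treeImage-cases x with visit (first x) ≟ x
  ... | yes v≡x = inj₁ (v≡x , refl)
  ... | no  v≢x = inj₂ (v≢x , refl)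

  treeImage-≃ : ∀ x → treeImage x ≃ tree x
  treeImage-≃ x = Data.Sum.map proj₂ proj₂ (treeImage-cases x)

  treeImage-injective : ∀ {x x'} → Visited x → ¬ x ∼ a → Visited x' → ¬ x' ∼ a →
    treeImage x ≡ treeImage x' → x ≡ x'
  treeImage-injective {x} {x'} vx x≁a vx' x'≁a eq
    with same-first ← ≃-tree-first vx x≁a vx' x'≁a (treeImage-≃ x) (subst (_≃ tree x') (sym eq) (treeImage-≃ x'))
       | treeImage-cases x | treeImage-cases x'
  ... | inj₁ (v≡x , _) | inj₁ (v≡x' , _) = trans (sym v≡x) (trans (cong visit same-first) v≡x')
  ... | inj₁ (_ , i≡t) | inj₂ (_ , i'≡Θt') = contradiction
    (sym (trans (sym i≡t) (trans eq (trans i'≡Θt' (cong (Θ θ ∘ edge) (sym same-first))))))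
    (splits-nonpal (tree-splits vx x≁a))
  ... | inj₂ (_ , i≡Θt) | inj₁ (_ , i'≡t') = contradiction
    (trans (sym i≡Θt) (trans eq (trans i'≡t' (cong edge (sym same-first)))))
    (splits-nonpal (tree-splits vx x≁a))
  ... | inj₂ (v≢x , _) | inj₂ (v≢x' , _) = θ-injective
    (trans (sym (∼-≢⇒≡θ (proj₂ (first-visited vx)) v≢x))
           (trans (cong visit same-first) (∼-≢⇒≡θ (proj₂ (first-visited vx')) v≢x')))

  palImage : Fin k → Word k
  palImage x = Θ θ (tree x)

  palImage-injective : ∀ {x x'} → θ x ≡ x → Visited x → θ x' ≡ x' → Visited x' →
    palImage x ≡ palImage x' → x ≡ x'
  palImage-injective px vx px' vx' eq =
    trans (sym (visit-first-pal px vx)) (trans (cong visit same-first) (visit-first-pal px' vx'))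
    where
    same-first = ≃-tree-first vx (pal⇒nonroot px) vx' (pal⇒nonroot px') (inj₂ refl) (inj₂ eq)

  treeImage≢palImage : ∀ {x x'} → Visited x → ¬ x ∼ a → θ x' ≡ x' → Visited x' →
    treeImage x ≢ palImage x'
  treeImage≢palImage {x} {x'} vx x≁a px' vx' eq
    with same-first ← ≃-tree-first vx x≁a vx' (pal⇒nonroot px') (treeImage-≃ x) (inj₂ eq)
       | treeImage-cases x
  ... | inj₁ (_ , i≡t) = splits-nonpal (tree-splits vx x≁a)
    (sym (trans (sym i≡t) (trans eq (cong (Θ θ ∘ edge) (sym same-first)))))
  ... | inj₂ (v≢x , _) = v≢x (trans v≡x' x'≡x)
    where
    v≡x' : visit (first x) ≡ x'
    v≡x' = trans (cong visit same-first) (visit-first-pal px' vx')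
    x'≡x : x' ≡ x
    x'≡x = trans (sym px') (trans (cong θ (trans (sym v≡x') (∼-≢⇒≡θ (proj₂ (first-visited vx)) v≢x))) (θ-inv x))

  letterImage : Fin k → Word k
  letterImage x with x ∼? a
  ... | yes _ = rootImage x
  ... | no  _ = treeImage x

  letterImage-injective : ∀ {x x'} → Visited x → Visited x' → letterImage x ≡ letterImage x' → x ≡ x'
  letterImage-injective {x} {x'} vx vx' eq with x ∼? a | x' ∼? a
  ... | yes x∼a | yes x'∼a = rootImage-injective x∼a x'∼a eq
  ... | yes x∼a | no x'≁a  =
    contradiction (subst (_≃ closing) eq (rootImage-≃ x∼a)) (tree≄closing vx' x'≁a (treeImage-≃ x'))
  ... | no x≁a  | yes x'∼a =
    contradiction (subst (_≃ closing) (sym eq) (rootImage-≃ x'∼a)) (tree≄closing vx x≁a (treeImage-≃ x))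
  ... | no x≁a  | no x'≁a  = treeImage-injective vx x≁a vx' x'≁a eq

  letterImage≢palImage : ∀ {x x'} → Visited x → θ x' ≡ x' → Visited x' → letterImage x ≢ palImage x'
  letterImage≢palImage {x} vx px' vx' eq with x ∼? a
  ... | yes x∼a = tree≄closing vx' (pal⇒nonroot px') (inj₂ refl) (subst (_≃ closing) eq (rootImage-≃ x∼a))
  ... | no x≁a  = treeImage≢palImage vx x≁a px' vx' eq

  letterImage-nonpal : ∀ {x} → Visited x → Θ θ (letterImage x) ≢ letterImage x
  letterImage-nonpal {x} vx with x ∼? a
  ... | yes x∼a = ≃-nonpal (rootImage-≃ x∼a) closing-nonpal
  ... | no x≁a  = ≃-nonpal (treeImage-≃ x) (splits-nonpal (tree-splits vx x≁a))

  palImage-nonpal : ∀ {x} → θ x ≡ x → Visited x → Θ θ (palImage x) ≢ palImage x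
  palImage-nonpal px vx = ≃-nonpal (inj₂ refl) (splits-nonpal (tree-splits vx (pal⇒nonroot px)))

  letterImage-edge : ∀ x → ∃[ ρ ] letterImage x ≃ edge ρ
  letterImage-edge x with x ∼? a
  ... | yes x∼a = r , rootImage-≃ x∼a
  ... | no _    = first x , treeImage-≃ x

  -- letters, Θ-palindromic letters and Θ-palindromic factors of length 2
  Domain : Set
  Domain = Word k ⊎ (Word k ⊎ Word k)

  Admissible : Domain → Set
  Admissible (inj₁ w)        = ∃[ x ] w ≡ x ∷ [] × Visited x
  Admissible (inj₂ (inj₁ w)) = ∃[ x ] w ≡ x ∷ [] × θ x ≡ x × Visited x
  Admissible (inj₂ (inj₂ w)) = Factor u w × length w ≡ 2 × Θ θ w ≡ w

  image : Domain → Word k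
  image (inj₁ (x ∷ []))        = letterImage x
  image (inj₂ (inj₁ (x ∷ []))) = palImage x
  image (inj₂ (inj₂ w))        = w
  image _                      = []

  image-factor : ∀ {d} → Admissible d → Factor u (image d) × length (image d) ≡ 2
  image-factor {inj₁ _}        (x , refl , _)     = ≃-edge-factor (proj₂ (letterImage-edge x))
  image-factor {inj₂ (inj₁ _)} (x , refl , _ , _) = ≃-edge-factor {ρ = first x} (inj₂ refl)
  image-factor {inj₂ (inj₂ _)} (f , l , _)        = f , l

  image-injective : ∀ {d d'} → Admissible d → Admissible d' → image d ≡ image d' → d ≡ d'
  image-injective {inj₁ _} {inj₁ _} (x , refl , vx) (x' , refl , vx') eq =
    cong (λ y → inj₁ (y ∷ [])) (letterImage-injective vx vx' eq)
  image-injective {inj₁ _} {inj₂ (inj₁ _)} (_ , refl , vx) (_ , refl , px' , vx') eq =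
    contradiction eq (letterImage≢palImage vx px' vx')
  image-injective {inj₂ (inj₁ _)} {inj₁ _} (_ , refl , px , vx) (_ , refl , vx') eq =
    contradiction (sym eq) (letterImage≢palImage vx' px vx)
  image-injective {inj₂ (inj₁ _)} {inj₂ (inj₁ _)} (_ , refl , px , vx) (_ , refl , px' , vx') eq =
    cong (λ y → inj₂ (inj₁ (y ∷ []))) (palImage-injective px vx px' vx' eq)
  image-injective {inj₁ _} {inj₂ (inj₂ _)} (_ , refl , vx) (_ , _ , pal) refl =
    contradiction pal (letterImage-nonpal vx)
  image-injective {inj₂ (inj₂ _)} {inj₁ _} (_ , _ , pal) (_ , refl , vx) eq =
    contradiction (subst (λ g → Θ θ g ≡ g) eq pal) (letterImage-nonpal vx)
  image-injective {inj₂ (inj₁ _)} {inj₂ (inj₂ _)} (_ , refl , px , vx) (_ , _ , pal) refl =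
    contradiction pal (palImage-nonpal px vx)
  image-injective {inj₂ (inj₂ _)} {inj₂ (inj₁ _)} (_ , _ , pal) (_ , refl , px , vx) eq =
    contradiction (subst (λ g → Θ θ g ≡ g) eq pal) (palImage-nonpal px vx)
  image-injective {inj₂ (inj₂ _)} {inj₂ (inj₂ _)} _ _ eq = cong (inj₂ ∘ inj₂) eq

  complexity-bound : (∀ x → Factor u (x ∷ []) → Visited x) → ∀ {c1 c2 p1 p2} →
    Complexity u 1 c1 → Complexity u 2 c2 → PalComplexity u θ 1 p1 → PalComplexity u θ 2 p2 →
    c1 + (p1 + p2) ≤ c2
  complexity-bound visited (L1 , L1! , refl , L1⇔) (L2 , _ , refl , L2⇔) (P1 , P1! , refl , P1⇔) (P2 , P2! , refl , P2⇔) =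
    subst (_≤ length L2) (trans (length-tagged L1 _) (cong (length L1 +_) (length-tagged P1 P2)))
      (length-≤-injection image (Unique-tagged L1! (Unique-tagged P1! P2!))
        (λ d∈ → Equivalence.from (L2⇔ _) (image-factor (All.lookup admissible d∈)))
        (λ d∈ d'∈ → image-injective (All.lookup admissible d∈) (All.lookup admissible d'∈)))
    where
    letter : ∀ {w} → w ∈ L1 → Admissible (inj₁ w)
    letter {w} w∈ with Equivalence.to (L1⇔ w) w∈
    letter {x ∷ []} _ | f , _ = x , refl , visited x f

    palLetter : ∀ {w} → w ∈ P1 → Admissible (inj₂ (inj₁ w))
    palLetter {w} w∈ with Equivalence.to (P1⇔ w) w∈
    palLetter {x ∷ []} _ | f , _ , pal = x , refl , ∷-injectiveˡ pal , visited x f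

    admissible : All Admissible (tagged L1 (tagged P1 P2))
    admissible = All-tagged (All.tabulate letter)
                   (All-tagged (All.tabulate palLetter) (All.tabulate (Equivalence.to (P2⇔ _))))

-- The indices 0, 1, …, D visit the positions s, s + 1, …, s + D of u, and the indices
-- D + 1, …, D + s then visit s − 1, …, 0; each index after 0 is adjacent in u to an earlier one.
module Window {k : ℕ} (u : InfWord k) (s D : ℕ) where

  pos : ℕ → ℕ
  pos ρ with ρ ≤? D
  ... | yes _ = s + ρ
  ... | no  _ = s ∸ suc (ρ ∸ suc D)

  start : ℕ → ℕ
  start ρ with ρ ≤? D
  ... | yes _ = pos (ρ ∸ 1)
  ... | no  _ = pos ρ

  private
    suc-∸-suc : ∀ {j} → j < s → suc (s ∸ suc j) ≡ s ∸ j
    suc-∸-suc j<s = sym (+-∸-assoc 1 j<s)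

    left≰D : ∀ j → suc D + j ≰ D
    left≰D j le = 1+n≰n (≤-trans (s≤s (m≤m+n D j)) le)

  pos-right : ∀ {ρ} → ρ ≤ D → pos ρ ≡ s + ρ
  pos-right {ρ} ρ≤D with ρ ≤? D
  ... | yes _   = refl
  ... | no ρ≰D = contradiction ρ≤D ρ≰D

  pos-left : ∀ j → pos (suc D + j) ≡ s ∸ suc j
  pos-left j with suc D + j ≤? D
  ... | yes le = contradiction le (left≰D j)
  ... | no _   = cong (λ i → s ∸ suc i) (m+n∸m≡n D j)

  start-right : ∀ {ρ} → ρ ≤ D → start ρ ≡ pos (ρ ∸ 1)
  start-right {ρ} ρ≤D with ρ ≤? D
  ... | yes _   = refl
  ... | no ρ≰D = contradiction ρ≤D ρ≰D

  start-left : ∀ j → start (suc D + j) ≡ s ∸ suc j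
  start-left j with suc D + j ≤? D
  ... | yes le = contradiction le (left≰D j)
  ... | no _   = pos-left j

  visit : ℕ → Fin k
  visit ρ = u (pos ρ)

  edge-right : ∀ {ρ} → 1 ≤ ρ → ρ ≤ D → factorAt u (start ρ) 2 ≡ visit (ρ ∸ 1) ∷ visit ρ ∷ []
  edge-right {suc ρ} _ ρ<D = begin
    factorAt u (start (suc ρ)) 2        ≡⟨ cong (λ i → factorAt u i 2) (start-right ρ<D) ⟩
    factorAt u (pos ρ) 2                ≡⟨ factorAt-2 u (pos ρ) ⟩
    u (pos ρ) ∷ u (suc (pos ρ)) ∷ []    ≡⟨ cong (λ i → u (pos ρ) ∷ u i ∷ []) suc-pos ⟩
    u (pos ρ) ∷ u (pos (suc ρ)) ∷ []    ∎
    where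
    open ≡-Reasoning
    suc-pos : suc (pos ρ) ≡ pos (suc ρ)
    suc-pos = trans (cong suc (pos-right (<⇒≤ ρ<D))) (trans (sym (+-suc s ρ)) (sym (pos-right ρ<D)))

  back : ℕ → ℕ
  back zero    = 0
  back (suc j) = suc D + j

  back-< : ∀ j → back j < suc D + j
  back-< zero    = s≤s z≤n
  back-< (suc j) = +-monoʳ-< (suc D) (n<1+n j)

  pos-back : ∀ j → pos (back j) ≡ s ∸ j
  pos-back zero    = trans (pos-right z≤n) (+-identityʳ s)
  pos-back (suc j) = pos-left j

  edge-left : ∀ j → j < s → factorAt u (start (suc D + j)) 2 ≡ visit (suc D + j) ∷ visit (back j) ∷ []
  edge-left j j<s = begin
    factorAt u (start (suc D + j)) 2   ≡⟨ cong (λ i → factorAt u i 2) (start-left j) ⟩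
    factorAt u (s ∸ suc j) 2           ≡⟨ factorAt-2 u (s ∸ suc j) ⟩
    u (s ∸ suc j) ∷ u (suc (s ∸ suc j)) ∷ [] ≡⟨ cong₂ _∷_ (cong u (sym (pos-left j))) (cong (λ i → u i ∷ []) suc-pos) ⟩
    visit (suc D + j) ∷ visit (back j) ∷ []  ∎
    where
    open ≡-Reasoning
    suc-pos : suc (s ∸ suc j) ≡ pos (back j)
    suc-pos = trans (suc-∸-suc j<s) (sym (pos-back j))

  side : ∀ ρ → ρ ≤ D ⊎ ∃[ j ] ρ ≡ suc D + j
  side ρ with ρ ≤? D
  ... | yes ρ≤D = inj₁ ρ≤D
  ... | no ρ≰D  = inj₂ (_ , sym (m+[n∸m]≡n (≰⇒> ρ≰D)))

  links-back : ∀ ρ → 1 ≤ ρ → ρ ≤ D + s → ∃[ ρ' ] ρ' < ρ ×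
    (factorAt u (start ρ) 2 ≡ visit ρ' ∷ visit ρ ∷ [] ⊎ factorAt u (start ρ) 2 ≡ visit ρ ∷ visit ρ' ∷ [])
  links-back (suc ρ) _ ρ<D+s with side (suc ρ)
  ... | inj₁ ρ<D        = ρ , ≤-refl , inj₁ (edge-right (s≤s z≤n) ρ<D)
  ... | inj₂ (j , refl) = back j , back-< j , inj₂ (edge-left j (+-cancelˡ-< D j s ρ<D+s))

  covers : ∀ {i} → i ≤ s + D → ∃[ ρ ] ρ ≤ D + s × pos ρ ≡ i
  covers {i} i≤s+D with s ≤? i
  ... | yes s≤i = i ∸ s , ≤-trans i∸s≤D (m≤m+n D s) , trans (pos-right i∸s≤D) (m+[n∸m]≡n s≤i)
    where
    i∸s≤D : i ∸ s ≤ D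
    i∸s≤D = subst (i ∸ s ≤_) (m+n∸m≡n s D) (∸-monoˡ-≤ s i≤s+D)
  ... | no s≰i = suc D + (s ∸ suc i) , index≤D+s , trans (pos-left (s ∸ suc i)) pos≡i
    where
    i<s : i < s
    i<s = ≰⇒> s≰i
    index≤D+s : suc D + (s ∸ suc i) ≤ D + s
    index≤D+s = ≤-trans (≤-reflexive (trans (sym (+-suc D _)) (cong (D +_) (suc-∸-suc i<s))))
                        (+-monoʳ-≤ D (m∸n≤m s i))
    pos≡i : s ∸ suc (s ∸ suc i) ≡ i
    pos≡i = trans (cong (s ∸_) (suc-∸-suc i<s)) (m∸[m∸n]≡n (<⇒≤ i<s))

no-gap : ∀ {k} (u : InfWord k) (θ : Fin k → Fin k) → IsInvolution θ → ClosedUnder u θ →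
  ∀ {c1 c2 p1 p2} → Complexity u 1 c1 → Complexity u 2 c2 →
  PalComplexity u θ 1 p1 → PalComplexity u θ 2 p2 → p1 + p2 ≡ (c2 ∸ c1) + 2 →
  ∀ b → b ≢ θ b → NoGap u b (θ b)
no-gap u θ θ-inv closed {c1} {c2} C1@(L1 , _ , _ , L1⇔) C2 P1 P2 p1+p2≡ b b≢θb
       (m , (i , occurs) , θb∉gap) =
  m+[n∸m+2]≰n c1 c2 (subst (λ p → c1 + p ≤ c2) p1+p2≡ (S.complexity-bound visited C1 C2 P1 P2))
  where
  gap = b ∷ m ++ b ∷ []
  r = suc (length m)
  occurs′ : applyUpTo (λ j → u (i + j)) (length gap) ≡ gap
  occurs′ = trans (sym (map-upTo (λ j → u (i + j)) (length gap))) occurs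

  bound = occurrence-bound u L1 (λ w∈ → proj₁ (Equivalence.to (L1⇔ _) w∈))
  B = proj₁ bound
  D = r + B
  open Window u i D

  r≤D : r ≤ D
  r≤D = m≤m+n r B

  visit-right : ∀ {t} → t ≤ r → visit t ≡ u (i + t)
  visit-right t≤r = cong u (pos-right (≤-trans t≤r r≤D))

  module S = Spanning u θ θ-inv closed visit start (D + i) links-back b b≢θb r (s≤s z≤n)
    (≤-trans r≤D (m≤m+n D i))
    (trans (visit-right z≤n) (∷-injectiveˡ occurs′))
    (trans (visit-right ≤-refl) (applyUpTo-last (λ j → u (i + j)) (b ∷ m) b occurs′))
    (λ t 1≤t t≤r → edge-right 1≤t (≤-trans t≤r r≤D))
    (λ t t≤r v≡θb → θb∉gap (subst (_∈ gap) (trans (sym (visit-right t≤r)) v≡θb)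
                                    (applyUpTo-∈ (λ j → u (i + j)) (b ∷ m) b occurs′ t≤r)))

  visited : ∀ x → Factor u (x ∷ []) → S.Visited x
  visited x f
    with j , j≤B , occ ← proj₂ bound (Equivalence.from (L1⇔ _) (f , refl))
    with ρ , ρ≤ , pos≡j ← covers (≤-trans j≤B (≤-trans (m≤n+m B r) (m≤n+m D i)))
    = ρ , ρ≤ , trans (cong u (trans pos≡j (sym (+-identityʳ j)))) (∷-injectiveˡ occ)

lemma4p7 : (k : ℕ) (u : InfWord k) (θ : Fin k → Fin k) → IsInvolution θ →
    ClosedUnder u θ →
    (c1 c2 p1 p2 : ℕ) →
    Complexity u 1 c1 → Complexity u 2 c2 →
    PalComplexity u θ 1 p1 → PalComplexity u θ 2 p2 →
    p1 + p2 ≡ (c2 ∸ c1) + 2 →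
    (a : Fin k) → ¬ (a ≡ θ a) → Alternate u a (θ a)
lemma4p7 k u θ θ-inv closed c1 c2 p1 p2 C1 C2 P1 P2 eq a a≢θa =
  no-gap′ a a≢θa ,
  subst (NoGap u (θ a)) (θ-inv a) (no-gap′ (θ a) (λ θa≡θθa → a≢θa (sym (trans θa≡θθa (θ-inv a)))))
  where no-gap′ = no-gap u θ θ-inv closed C1 C2 P1 P2 eq
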